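{- Let $\mathcal{H}$ be a hypergraph with ground set $\Omega$. If $\mathcal{H}$ is a domination hypergraph, then $|tr(\mathcal{H})|\le|\Omega|$.
   Context: Graphs are finite, simple, undirected. A dominating set of a graph $G$ is a set $D\subseteq V(G)$ such that every vertex not in $D$ is adjacent to some vertex of $D$; $\mathcal{D}(G)$ is the family of inclusion-minimal dominating sets. A hypergraph on a finite set $\Omega$ is a nonempty family of nonempty subsets of $\Omega$ none of which is a proper subset of another; it has ground set $\Omega$ if the union of its members is $\Omega$. $\mathcal{H}$ is a domination hypergraph if $\mathcal{H}=\mathcal{D}(G)$ for some graph $G$. The transversal $tr(\mathcal{A})$ of a family $\mathcal{A}$ is the family of inclusion-minimal sets $X$ with $X\cap A\neq\emptyset$ for all $A\in\mathcal{A}$. -}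

module Defs where

open import Data.Nat using (ℕ; _≤_)
open import Data.Bool using (Bool; true; false)
open import Data.Fin using (Fin)
open import Data.Fin.Subset using (Subset; _∈_; _⊆_; _⊂_; Nonempty)
open import Data.Product using (Σ; _×_; ∃; ∃-syntax)
open import Data.Sum using (_⊎_)
open import Data.List using (List; length)
open import Data.List.Relation.Unary.All using (All)
open import Data.List.Relation.Unary.Unique.Propositional using (Unique)
open import Relation.Nullary using (¬_)
open import Relation.Binary.PropositionalEquality using (_≡_)

record Graph (n : ℕ) : Set where
  field
    adj       : Fin n → Fin n → Bool
    symmetric : ∀ u v → adj u v ≡ adj v u
    loopless  : ∀ v → adj v v ≡ false
open Graph public

Family : ℕ → Set₁
Family n = Subset n → Set

Dominating : ∀ {n} → Graph n → Subset n → Set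
Dominating G D = ∀ v → v ∈ D ⊎ ∃[ u ] (u ∈ D × adj G u v ≡ true)

MinDominating : ∀ {n} → Graph n → Family n
MinDominating G D = Dominating G D × (∀ D′ → D′ ⊂ D → ¬ Dominating G D′)

record IsHypergraphOnGround {n : ℕ} (H : Family n) : Set where
  field
    nonemptyFamily : ∃[ A ] H A
    nonemptyEdges  : ∀ A → H A → Nonempty A
    antichain      : ∀ A B → H A → H B → ¬ (A ⊂ B)
    covers         : ∀ (x : Fin n) → ∃[ A ] (H A × x ∈ A)

IsDominationHypergraph : ∀ {n} → Family n → Set
IsDominationHypergraph {n} H =
  Σ (Graph n) λ G → ∀ X → (H X → MinDominating G X) × (MinDominating G X → H X)

Transversal : ∀ {n} → Family n → Subset n → Set
Transversal H X = ∀ A → H A → ∃[ x ] (x ∈ X × x ∈ A)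

tr : ∀ {n} → Family n → Family n
tr H X = Transversal H X × (∀ Y → Y ⊂ X → ¬ Transversal H Y)

-- |F| ≤ k for a family F of subsets: every duplicate-free list of members has length ≤ k
CardAtMost : ∀ {n} → Family n → ℕ → Set
CardAtMost F k = ∀ (L : List (Subset _)) → Unique L → All F L → length L ≤ k

-- Every minimal transversal of 𝒟(G) is a closed neighbourhood N[v]. Indeed, N[v] meets
-- every dominating set; and if a transversal X contained no N[v], then every vertex of X
-- would have a neighbour outside X, so ∁ X would dominate and contain a minimal dominating
-- set missed by X. Minimality of X then forces X = N[v], so tr(𝒟(G)) has at most |Ω| members.
module Submission where

open import Defs
open import Data.Nat using (ℕ; _≤_)
open import Data.Bool using (true; _∨_)
open import Data.Bool.Properties using () renaming (_≟_ to _≟ᵇ_)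
open import Data.Fin using (Fin; zero; suc)
open import Data.Fin.Properties using (any?; all?; injective⇒≤) renaming (_≟_ to _≟ᶠ_)
open import Data.Fin.Subset using (Subset; _∈_; _∉_; _⊆_; _⊈_; _⊂_; ∁)
open import Data.Fin.Subset.Properties
  using (_∈?_; _⊆?_; _⊂?_; anySubset?; p⊂q⇒p⊆q; ⊆-trans; ⊆-antisym; x∉p⇒x∈∁p; x∈∁p⇒x∉p)
open import Data.Fin.Subset.Induction using (⊂-wellFounded)
open import Data.Vec using (tabulate)
open import Data.Vec.Properties using ([]=⇒lookup; lookup⇒[]=; lookup∘tabulate)
open import Data.Product using (_×_; _,_; proj₁; proj₂; ∃-syntax)
open import Data.Sum using (_⊎_; inj₁; inj₂)
open import Data.Empty using (⊥-elim)
open import Data.List using (List; length; lookup)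
open import Data.List.Membership.Propositional.Properties using (∈-lookup)
open import Data.List.Relation.Unary.All as All using (All)
open import Data.List.Relation.Unary.AllPairs using (_∷_)
open import Data.List.Relation.Unary.Unique.Propositional using (Unique)
open import Function using (id)
open import Induction.WellFounded using (Acc; acc)
open import Relation.Nullary using (¬_; yes; no; does; contradiction)
open import Relation.Nullary.Decidable using (_×-dec_; _⊎-dec_; ¬?)
open import Relation.Unary using (Decidable)
open import Relation.Binary.PropositionalEquality using (_≡_; refl; sym; trans; cong; module ≡-Reasoning)

lookup-injective : ∀ {A : Set} {xs : List A} → Unique xs →
                   ∀ i j → lookup xs i ≡ lookup xs j → i ≡ j
lookup-injective (x∉xs ∷ u) zero    zero    _ = refl
lookup-injective (x∉xs ∷ u) zero    (suc j) e = contradiction e (All.lookup x∉xs (∈-lookup j))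
lookup-injective (x∉xs ∷ u) (suc i) zero    e = contradiction (sym e) (All.lookup x∉xs (∈-lookup i))
lookup-injective (x∉xs ∷ u) (suc i) (suc j) e = cong suc (lookup-injective u i j e)

unique-⊆-image⇒length≤ : ∀ {A : Set} {k} (f : Fin k → A) {xs : List A} → Unique xs →
                          All (λ x → ∃[ i ] f i ≡ x) xs → length xs ≤ k
unique-⊆-image⇒length≤ {k = k} f {xs} u inImage = injective⇒≤ preimage-injective
  where
  preimage : Fin (length xs) → Fin k
  preimage i = proj₁ (All.lookup inImage (∈-lookup i))

  preimage-injective : ∀ {i j} → preimage i ≡ preimage j → i ≡ j
  preimage-injective {i} {j} e = lookup-injective u i j (begin
    lookup xs i     ≡⟨ sym (proj₂ (All.lookup inImage (∈-lookup i))) ⟩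
    f (preimage i)  ≡⟨ cong f e ⟩
    f (preimage j)  ≡⟨ proj₂ (All.lookup inImage (∈-lookup j)) ⟩
    lookup xs j     ∎)
    where open ≡-Reasoning

CardAtMost-image : ∀ {n k} {F : Family n} (f : Fin k → Subset n) →
                   (∀ X → F X → ∃[ i ] f i ≡ X) → CardAtMost F k
CardAtMost-image f F⊆image xs u Fxs =
  unique-⊆-image⇒length≤ f u (All.map (λ {X} → F⊆image X) Fxs)

module _ {n : ℕ} where

  ⊈⇒∃∉ : ∀ {p q : Subset n} → p ⊈ q → ∃[ x ] x ∈ p × x ∉ q
  ⊈⇒∃∉ {p} {q} p⊈q with any? (λ x → (x ∈? p) ×-dec ¬? (x ∈? q))
  ... | yes witness = witness
  ... | no none     = ⊥-elim (p⊈q p⊆q)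
    where
    p⊆q : p ⊆ q
    p⊆q {x} x∈p with x ∈? q
    ... | yes x∈q = x∈q
    ... | no  x∉q = contradiction (x , x∈p , x∉q) none

  ⊆-minimal : {P : Subset n → Set} → Decidable P → ∀ {S} → P S →
              ∃[ D ] D ⊆ S × P D × (∀ D′ → D′ ⊂ D → ¬ P D′)
  ⊆-minimal {P} P? {S} = go (⊂-wellFounded S)
    where
    go : ∀ {S} → Acc _⊂_ S → P S → ∃[ D ] D ⊆ S × P D × (∀ D′ → D′ ⊂ D → ¬ P D′)
    go {S} (acc below) PS with anySubset? (λ D → (D ⊂? S) ×-dec P? D)
    ... | yes (T , T⊂S , PT) =
      let D , D⊆T , minimal = go (below T⊂S) PT in D , ⊆-trans D⊆T (p⊂q⇒p⊆q T⊂S) , minimal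
    ... | no  none = S , id , PS , λ D′ D′⊂S PD′ → none (D′ , D′⊂S , PD′)

  tr-⊆⇒≡ : ∀ {H : Family n} {X Y} → tr H X → Transversal H Y → Y ⊆ X → Y ≡ X
  tr-⊆⇒≡ {Y = Y} (_ , minimal) trY Y⊆X = ⊆-antisym Y⊆X X⊆Y
    where
    X⊆Y : _ ⊆ Y
    X⊆Y {x} x∈X with x ∈? Y
    ... | yes x∈Y = x∈Y
    ... | no  x∉Y = contradiction trY (minimal Y (Y⊆X , x , x∈X , x∉Y))

module _ {n : ℕ} (G : Graph n) where

  closedNbhd : Fin n → Subset n
  closedNbhd v = tabulate (λ u → does (u ≟ᶠ v) ∨ adj G v u)

  ∈-closedNbhd⁻ : ∀ {v u} → u ∈ closedNbhd v → u ≡ v ⊎ adj G v u ≡ true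
  ∈-closedNbhd⁻ {v} {u} u∈N with u ≟ᶠ v | trans (sym (lookup∘tabulate _ u)) ([]=⇒lookup u∈N)
  ... | yes u≡v | _        = inj₁ u≡v
  ... | no  _   | adj≡true = inj₂ adj≡true

  ∈-closedNbhd⁺ : ∀ {v u} → u ≡ v ⊎ adj G v u ≡ true → u ∈ closedNbhd v
  ∈-closedNbhd⁺ {v} {u} u~v = lookup⇒[]= u (closedNbhd v) (trans (lookup∘tabulate _ u) (memberBit u~v))
    where
    memberBit : u ≡ v ⊎ adj G v u ≡ true → does (u ≟ᶠ v) ∨ adj G v u ≡ true
    memberBit u~v with u ≟ᶠ v | u~v
    ... | yes _   | _             = refl
    ... | no  _   | inj₂ adj≡true = adj≡true
    ... | no  u≢v | inj₁ u≡v      = contradiction u≡v u≢v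

  dominating? : Decidable (Dominating G)
  dominating? S = all? λ v → (v ∈? S) ⊎-dec any? λ u → (u ∈? S) ×-dec (adj G u v ≟ᵇ true)

  closedNbhd-meets-dominating : ∀ v {D} → Dominating G D → ∃[ x ] x ∈ closedNbhd v × x ∈ D
  closedNbhd-meets-dominating v dom with dom v
  ... | inj₁ v∈D           = v , ∈-closedNbhd⁺ (inj₁ refl) , v∈D
  ... | inj₂ (u , u∈D , a) = u , ∈-closedNbhd⁺ (inj₂ (trans (symmetric G v u) a)) , u∈D

  no-closedNbhd-⊆⇒∁-dominating : ∀ {X} → (∀ v → closedNbhd v ⊈ X) → Dominating G (∁ X)
  no-closedNbhd-⊆⇒∁-dominating {X} N⊈X v with v ∈? X
  ... | no  v∉X = inj₁ (x∉p⇒x∈∁p v∉X)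
  ... | yes v∈X with ⊈⇒∃∉ (N⊈X v)
  ... | u , u∈N , u∉X with ∈-closedNbhd⁻ u∈N
  ... | inj₁ refl = contradiction v∈X u∉X
  ... | inj₂ a    = inj₂ (u , x∉p⇒x∈∁p u∉X , trans (symmetric G u v) a)

  module _ {H : Family n} (H⇔𝒟 : ∀ X → (H X → MinDominating G X) × (MinDominating G X → H X)) where

    closedNbhd-transversal : ∀ v → Transversal H (closedNbhd v)
    closedNbhd-transversal v A HA = closedNbhd-meets-dominating v (proj₁ (proj₁ (H⇔𝒟 A) HA))

    transversal⇒closedNbhd-⊆ : ∀ {X} → Transversal H X → ∃[ v ] closedNbhd v ⊆ X
    transversal⇒closedNbhd-⊆ {X} trX with any? (λ v → closedNbhd v ⊆? X)
    ... | yes found = found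
    ... | no  none
      with ⊆-minimal dominating? (no-closedNbhd-⊆⇒∁-dominating λ v N⊆X → none (v , N⊆X))
    ... | D , D⊆∁X , minDom with trX D (proj₂ (H⇔𝒟 D) minDom)
    ... | x , x∈X , x∈D = contradiction x∈X (x∈∁p⇒x∉p (D⊆∁X x∈D))

    tr⇒closedNbhd : ∀ X → tr H X → ∃[ v ] closedNbhd v ≡ X
    tr⇒closedNbhd X trX =
      let v , N⊆X = transversal⇒closedNbhd-⊆ (proj₁ trX)
      in  v , tr-⊆⇒≡ trX (closedNbhd-transversal v) N⊆X

lemma2p5 : (n : ℕ) (H : Family n) → IsHypergraphOnGround H →
           IsDominationHypergraph H → CardAtMost (tr H) n
lemma2p5 n H _ (G , H⇔𝒟) = CardAtMost-image (closedNbhd G) (tr⇒closedNbhd G H⇔𝒟)
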